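{- The dynamical system $\langle\mathcal P(\omega)/\mathrm{Fin},\sigma\rangle$ is polarized.
   Context: $\mathcal P(\omega)/\mathrm{Fin}$ is $\mathcal P(\omega)$ modulo finite sets, $\sigma([A])=[A+1]$. For a Boolean algebra $\mathbb A$ with automorphism $\alpha$: a partition of $\mathbb A$ is a finite set of nonzero pairwise disjoint elements with join $\mathbf 1$; $\mathcal A'$ refines $\mathcal A$ if each member of $\mathcal A'$ is below a member of $\mathcal A$, with natural map $\pi:\mathcal A'\to\mathcal A$; the digraph $\langle\mathcal A,\to_\alpha\rangle$ has $x\to_\alpha y$ iff $\alpha(x)\wedge y\ne\mathbf 0$. Digraphs are finite; strongly connected means every vertex reaches every vertex by a walk. An epimorphism $\phi:\langle\mathcal V,\to_{\mathcal V}\rangle\to\langle\mathcal U,\to_{\mathcal U}\rangle$ is a surjection with $u\to_{\mathcal U}u'$ iff some $v\in\phi^{ -1}(u),v'\in\phi^{ -1}(u')$ have $v\to_{\mathcal V}v'$. A virtual refinement of $\langle\mathcal A,\to_\alpha\rangle$ is $(\phi,\langle\mathcal V,\to\rangle)$ with $\langle\mathcal V,\to\rangle$ strongly connected and $\phi$ an epimorphism onto $\langle\mathcal A,\to_\alpha\rangle$; a partition $\mathcal A'$ realizes it if $\mathcal A'$ refines $\mathcal A$ and some digraph isomorphism $\psi:\langle\mathcal V,\to\rangle\to\langle\mathcal A',\to_\alpha\rangle$ satisfies $\pi\circ\psi=\phi$. Epimorphisms $\phi,\psi$ from strongly connected digraphs onto the same digraph are compatible if there are a strongly connected digraph $\mathcal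 W$ and epimorphisms $\bar\phi,\bar\psi$ from $\mathcal W$ onto their domains with $\phi\circ\bar\phi=\psi\circ\bar\psi$; otherwise incompatible. A virtual refinement $(\phi,\langle\mathcal V,\to\rangle)$ of $\langle\mathcal A,\to_\alpha\rangle$ is polarized if either some partition realizes it or some partition $\mathcal A'$ refining $\mathcal A$ has natural map $\pi:\langle\mathcal A',\to_\alpha\rangle\to\langle\mathcal A,\to_\alpha\rangle$ incompatible with $\phi$. The system is polarized if every virtual refinement of every $\langle\mathcal A,\to_\alpha\rangle$ is polarized. -}

module Defs where

open import Level using (0ℓ) renaming (suc to lsuc)
open import Data.Nat using (ℕ; zero; suc; _≤_)
open import Data.Bool using (Bool; true; false; _∧_; not)
open import Data.Fin using (Fin)
open import Data.Product using (Σ; ∃; _×_; _,_; ∃-syntax)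
open import Data.Sum using (_⊎_)
open import Relation.Nullary using (¬_)
open import Relation.Binary.PropositionalEquality using (_≡_; _≢_)
open import Relation.Binary.Construct.Closure.ReflexiveTransitive using (Star)
open import Function.Definitions using (Bijective)

-- P(ω)/Fin, presented by representatives: subsets of ω as characteristic
-- functions; equality/order/zero are taken modulo finite sets.

Subset : Set
Subset = ℕ → Bool

IsZero : Subset → Set
IsZero A = ∃[ N ] (∀ n → N ≤ n → A n ≡ false)

Nonzero : Subset → Set
Nonzero A = ¬ IsZero A

_⊓_ : Subset → Subset → Subset
(A ⊓ B) n = A n ∧ B n

_≤*_ : Subset → Subset → Set
A ≤* B = IsZero (λ n → A n ∧ not (B n))

σ : Subset → Subset
σ A zero    = false
σ A (suc n) = A n

-- Partitions of P(ω)/Fin: finitely many nonzero, pairwise disjoint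
-- elements whose join is 1 (i.e. the complement of the union is finite).

record Partition : Set where
  field
    size     : ℕ
    part     : Fin size → Subset
    nonzero  : ∀ i → Nonzero (part i)
    disjoint : ∀ i j → i ≢ j → IsZero (part i ⊓ part j)
    covers   : ∃[ N ] (∀ n → N ≤ n → ∃[ i ] (part i n ≡ true))
open Partition public

-- P' refines P, with π the natural map (each member of P' lies below
-- the member π j of P; π is uniquely determined by this).
Refines : (P' P : Partition) → (Fin (size P') → Fin (size P)) → Set
Refines P' P π = ∀ j → part P' j ≤* part P (π j)

record Digraph : Set₁ where
  field
    V : ℕ
    E : Fin V → Fin V → Set
open Digraph public

StronglyConnected : Digraph → Set
StronglyConnected G = ∀ u v → Star (E G) u v

Gσ : Partition → Digraph
Gσ P = record { V = size P ; E = λ i j → Nonzero (σ (part P i) ⊓ part P j) }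

Epi : (G H : Digraph) → (Fin (V G) → Fin (V H)) → Set
Epi G H φ =
  (∀ u → ∃[ v ] (φ v ≡ u)) ×
  (∀ u u' → E H u u' → ∃[ v ] ∃[ v' ] (φ v ≡ u × φ v' ≡ u' × E G v v')) ×
  (∀ v v' → E G v v' → E H (φ v) (φ v'))

Iso : (G H : Digraph) → (Fin (V G) → Fin (V H)) → Set
Iso G H ψ =
  Bijective _≡_ _≡_ ψ ×
  (∀ v v' → (E G v v' → E H (ψ v) (ψ v')) × (E H (ψ v) (ψ v') → E G v v'))

IsVirtualRefinement : (P : Partition) (𝒱 : Digraph) → (Fin (V 𝒱) → Fin (size P)) → Set
IsVirtualRefinement P 𝒱 φ = StronglyConnected 𝒱 × Epi 𝒱 (Gσ P) φ

Realizes : (P' P : Partition) (𝒱 : Digraph) → (Fin (V 𝒱) → Fin (size P)) → Set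
Realizes P' P 𝒱 φ =
  Σ (Fin (size P') → Fin (size P)) λ π → Refines P' P π ×
  Σ (Fin (V 𝒱) → Fin (size P')) λ ψ → Iso 𝒱 (Gσ P') ψ × (∀ v → π (ψ v) ≡ φ v)

Compatible : {𝒰 : Digraph} (𝒱 : Digraph) → (Fin (V 𝒱) → Fin (V 𝒰)) →
             (𝒱' : Digraph) → (Fin (V 𝒱') → Fin (V 𝒰)) → Set₁
Compatible 𝒱 φ 𝒱' ψ =
  Σ Digraph λ 𝒲 → StronglyConnected 𝒲 ×
  Σ (Fin (V 𝒲) → Fin (V 𝒱)) λ φ̄ → Σ (Fin (V 𝒲) → Fin (V 𝒱')) λ ψ̄ →
    Epi 𝒲 𝒱 φ̄ × Epi 𝒲 𝒱' ψ̄ × (∀ w → φ (φ̄ w) ≡ ψ (ψ̄ w))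

Polarized : (P : Partition) (𝒱 : Digraph) → (Fin (V 𝒱) → Fin (size P)) → Set₁
Polarized P 𝒱 φ =
  (Σ Partition λ P' → Realizes P' P 𝒱 φ) ⊎
  (Σ Partition λ P' → Σ (Fin (size P') → Fin (size P)) λ π →
     Refines P' P π × ¬ Compatible {Gσ P} 𝒱 φ (Gσ P') π)

SystemPolarized : Set₁
SystemPolarized = ∀ (P : Partition) (𝒱 : Digraph) (φ : Fin (V 𝒱) → Fin (size P)) →
  IsVirtualRefinement P 𝒱 φ → Polarized P 𝒱 φ

-- Colour each n ∈ ω by the member c n of P containing it. By Ramsey's theorem there are cut
-- points t₀ < t₁ < ⋯ such that all blocks [tₖ, tₖ₊₁] admit the same walks of 𝒱 lying over c
-- (recorded by their endpoints and whether they traverse a given edge). Label each position n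
-- by c n, by whether n is a cut point, and by the walks over c from the last cut point up to n;
-- the labels occurring infinitely often form a partition P′ refining P. If W witnesses that
-- P′ → P is compatible with φ, every edge of W is realised by consecutive positions of P′, so
-- walking around W is shadowed by walks of 𝒱 over c: inside a block the label records the
-- partial walk, and at a cut point the finished block can be moved to any other block. A closed
-- walk of W through a lift of an edge x → y of 𝒱 therefore yields a walk over c through whole
-- blocks from a fixed vertex back to itself that uses x → y. Chaining these for all edges and
-- repeating forever gives a walk over c using every edge of 𝒱 infinitely often, and the
-- partition of ω by this walk realizes (φ, 𝒱). So if (φ, 𝒱) is not realized, P′ is incompatible
-- with it.

module Submission where

open import Defs
open import Level using (0ℓ; Lift; lift; lower) renaming (suc to lsuc)
open import Axiom.ExcludedMiddle using (ExcludedMiddle)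
open import Function using (_∘_; id)
open import Function.Bundles using (Injection; _↣_; mk↣; _↔_; Inverse)
open import Function.Construct.Composition using (_↣-∘_; _↔-∘_)
import Function.Construct.Identity as Identity
open import Function.Properties.Inverse using (↔⇒↣; ↔-sym)
open import Data.Product.Function.NonDependent.Propositional using (_×-↣_; _×-↔_)
open import Data.Nat using (ℕ; zero; suc; _+_; _*_; _≤_; _<_; z≤n; s≤s; z<s; _⊔_; _≟_)
open import Data.Nat.Properties
open import Data.Bool using (Bool; true; false; _∧_; _∨_; not) renaming (_≟_ to _≟ᵇ_)
open import Data.Bool.Properties using (¬-not; ∧-conicalˡ; ∧-conicalʳ; ∨-identityʳ; ∨-zeroʳ)
open import Data.Fin using (Fin; zero; suc; punchIn; punchOut) renaming (_≟_ to _≟ᶠ_)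
open import Data.Fin.Properties using (2↔Bool; *↔×; punchIn-punchOut; any?)
open import Data.Product using (Σ; ∃-syntax; _×_; _,_; proj₁; proj₂)
open import Data.Product.Properties using (,-injective)
open import Data.Sum using (_⊎_; inj₁; inj₂)
open import Data.Unit using (⊤; tt)
open import Data.Empty using (⊥)
open import Data.Vec using (Vec; []; _∷_; lookup; tabulate; uncons)
open import Data.Vec.Properties using (lookup∘tabulate)
open import Data.List using ([]; _∷_; allFin; cartesianProduct)
open import Data.List.Membership.Propositional using (_∈_)
open import Data.List.Membership.Propositional.Properties using (∈-allFin; ∈-cartesianProduct⁺)
open import Data.List.Relation.Unary.Any using (here; there)
open import Relation.Nullary using (¬_; Dec; yes; no; does; contradiction)
open import Relation.Nullary.Decidable using (dec-true; dec-false; decidable-stable)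
import Relation.Nullary.Decidable as Dec
open import Relation.Binary.Definitions using (tri<; tri≈; tri>)
open import Relation.Binary.PropositionalEquality
open import Relation.Binary.Construct.Closure.ReflexiveTransitive using (Star; ε; _◅_)

private
  variable
    A B : Set
    K : ℕ

InfinitelyOften : (ℕ → Set) → Set
InfinitelyOften Q = ∀ N → ∃[ n ] (N ≤ n × Q n)

Eventually : (ℕ → Set) → Set
Eventually Q = ∃[ N ] (∀ n → N ≤ n → Q n)

StrictlyIncreasing : (ℕ → ℕ) → Set
StrictlyIncreasing u = ∀ k → u k < u (suc k)

Recurrent : (ℕ → Fin K) → Set
Recurrent h = ∀ j → InfinitelyOften (λ n → h n ≡ j)

does-true : {P : Set} (p? : Dec P) → does p? ≡ true → P
does-true (yes p) _ = p

InfinitelyOften⇒Nonzero : (X : Subset) → InfinitelyOften (λ n → X n ≡ true) → Nonzero X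
InfinitelyOften⇒Nonzero X often (N , finite) with often N
... | n , N≤n , Xn≡true with trans (sym Xn≡true) (finite n N≤n)
... | ()

eventually-∧ : {P Q : ℕ → Set} → Eventually P → Eventually Q → Eventually (λ n → P n × Q n)
eventually-∧ (M , p) (N , q) = M ⊔ N , λ n M⊔N≤n →
  p n (m⊔n≤o⇒m≤o M N M⊔N≤n) , q n (m⊔n≤o⇒n≤o M N M⊔N≤n)

eventually-∀ : {Q : Fin K → ℕ → Set} → (∀ i → Eventually (Q i)) → Eventually (λ n → ∀ i → Q i n)
eventually-∀ {zero}  _  = 0 , λ _ _ ()
eventually-∀ {suc K} ev with eventually-∧ (ev zero) (eventually-∀ (ev ∘ suc))
... | N , both = N , λ { n N≤n zero → proj₁ (both n N≤n) ; n N≤n (suc i) → proj₂ (both n N≤n) i }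

module _ {Q : ℕ → Set} (often : InfinitelyOften Q) where

  enumerate : ℕ → ℕ
  enumerate zero    = proj₁ (often 0)
  enumerate (suc k) = proj₁ (often (suc (enumerate k)))

  enumerate-increasing : StrictlyIncreasing enumerate
  enumerate-increasing k = proj₁ (proj₂ (often (suc (enumerate k))))

  enumerate-satisfies : ∀ k → Q (enumerate k)
  enumerate-satisfies zero    = proj₂ (proj₂ (often 0))
  enumerate-satisfies (suc k) = proj₂ (proj₂ (often (suc (enumerate k))))

Finite : Set → Set
Finite A = ∃[ K ] (A ↣ Fin K)

finite-Fin : ∀ K → Finite (Fin K)
finite-Fin K = K , ↔⇒↣ (Identity.↔-id _)

finite-Bool : Finite Bool
finite-Bool = 2 , ↔⇒↣ (↔-sym 2↔Bool)

finite-× : Finite A → Finite B → Finite (A × B)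
finite-× (m , ι) (n , κ) = m * n , ↔⇒↣ (↔-sym *↔×) ↣-∘ (ι ×-↣ κ)

finite-Vec : Finite A → ∀ n → Finite (Vec A n)
finite-Vec _ zero    = 1 , mk↣ {to = λ _ → zero} λ { {[]} {[]} _ → refl }
finite-Vec {A} finA (suc n) = proj₁ finA×Vec , proj₂ finA×Vec ↣-∘ mk↣ {to = uncons} uncons-injective
  where
  finA×Vec : Finite (A × Vec A n)
  finA×Vec = finite-× finA (finite-Vec finA n)
  uncons-injective : ∀ {xs ys : Vec A (suc n)} → uncons xs ≡ uncons ys → xs ≡ ys
  uncons-injective {_ ∷ _} {_ ∷ _} refl = refl

Fin-*-↔ : ∀ {m} n → Fin m ↔ A → Fin (n * m) ↔ (Fin n × A)
Fin-*-↔ n e = (Identity.↔-id _ ×-↔ e) ↔-∘ *↔×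

module Increasing {u : ℕ → ℕ} (u-increasing : StrictlyIncreasing u) where

  increasing-< : ∀ {i j} → i < j → u i < u j
  increasing-< {i} {suc j} i<1+j with m≤n⇒m<n∨m≡n (≤-pred i<1+j)
  ... | inj₁ i<j = <-trans (increasing-< i<j) (u-increasing j)
  ... | inj₂ refl = u-increasing i

  increasing-≤ : ∀ {i j} → i ≤ j → u i ≤ u j
  increasing-≤ i≤j with m≤n⇒m<n∨m≡n i≤j
  ... | inj₁ i<j  = <⇒≤ (increasing-< i<j)
  ... | inj₂ refl = ≤-refl

  increasing-inflationary : ∀ k → k ≤ u k
  increasing-inflationary zero    = z≤n
  increasing-inflationary (suc k) = ≤-trans (s≤s (increasing-inflationary k)) (u-increasing k)

  InBlock : ℕ → ℕ → Set
  InBlock K n = u K ≤ n × n < u (suc K)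

  inBlock-start : ∀ K → InBlock K (u K)
  inBlock-start K = ≤-refl , u-increasing K

  inBlock-suc : ∀ {K n} → InBlock K n → InBlock K (suc n) ⊎ u (suc K) ≡ suc n
  inBlock-suc (uK≤n , n<uK+1) with m≤n⇒m<n∨m≡n n<uK+1
  ... | inj₁ 1+n<uK+1 = inj₁ (m≤n⇒m≤1+n uK≤n , 1+n<uK+1)
  ... | inj₂ 1+n≡uK+1 = inj₂ (sym 1+n≡uK+1)

  inBlock-unique : ∀ {K K′ n} → InBlock K n → InBlock K′ n → K ≡ K′
  inBlock-unique {K} {K′} (uK≤n , n<uK+1) (uK′≤n , n<uK′+1) with <-cmp K K′
  ... | tri≈ _ K≡K′ _ = K≡K′
  ... | tri< K<K′ _ _ = contradiction (<-≤-trans n<uK+1 (≤-trans (increasing-≤ K<K′) uK′≤n)) (n≮n _)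
  ... | tri> _ _ K′<K = contradiction (<-≤-trans n<uK′+1 (≤-trans (increasing-≤ K′<K) uK≤n)) (n≮n _)

  inBlock-exists : ∀ n → u 0 ≤ n → ∃[ K ] InBlock K n
  inBlock-exists zero    u₀≤0 = 0 , u₀≤0 , ≤-<-trans z≤n (u-increasing 0)
  inBlock-exists (suc n) u₀≤1+n with m≤n⇒m<n∨m≡n u₀≤1+n
  ... | inj₂ u₀≡1+n = 0 , subst (InBlock 0) u₀≡1+n (inBlock-start 0)
  ... | inj₁ u₀<1+n with inBlock-exists n (≤-pred u₀<1+n)
  ... | K , inK with inBlock-suc inK
  ... | inj₁ inK′    = K , inK′
  ... | inj₂ uK+1≡1+n = suc K , subst (InBlock (suc K)) uK+1≡1+n (inBlock-start (suc K))

  block : ℕ → ℕ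
  block n with u 0 ≤? n
  ... | yes u₀≤n = proj₁ (inBlock-exists n u₀≤n)
  ... | no _     = 0

  inBlock-block : ∀ {n} → u 0 ≤ n → InBlock (block n) n
  inBlock-block {n} u₀≤n with u 0 ≤? n
  ... | yes u₀≤n′ = proj₂ (inBlock-exists n u₀≤n′)
  ... | no u₀≰n   = contradiction u₀≤n u₀≰n

  block-unique : ∀ {K n} → InBlock K n → block n ≡ K
  block-unique {K} inK = inBlock-unique (inBlock-block (≤-trans (increasing-≤ z≤n) (proj₁ inK))) inK

  block-suc : ∀ {n} → u 0 ≤ n →
              block (suc n) ≡ block n ⊎ (u (suc (block n)) ≡ suc n × block (suc n) ≡ suc (block n))
  block-suc u₀≤n with inBlock-suc (inBlock-block u₀≤n)
  ... | inj₁ inBlock-1+n = inj₁ (block-unique inBlock-1+n)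
  ... | inj₂ u≡1+n       = inj₂ (u≡1+n , block-unique (subst (InBlock _) u≡1+n (inBlock-start _)))

splice : ℕ → (ℕ → A) → (ℕ → A) → ℕ → A
splice b f g m with m ≤? b
... | yes _ = f m
... | no _  = g m

splice-≤ : ∀ {b m} (f g : ℕ → A) → m ≤ b → splice b f g m ≡ f m
splice-≤ {b = b} {m} f g m≤b with m ≤? b
... | yes _   = refl
... | no m≰b  = contradiction m≤b m≰b

splice-> : ∀ {b m} (f g : ℕ → A) → b < m → splice b f g m ≡ g m
splice-> {b = b} {m} f g b<m with m ≤? b
... | yes m≤b = contradiction b<m (≤⇒≯ m≤b)
... | no _    = refl

colourPartition : (h : ℕ → Fin K) → Recurrent h → Partition
colourPartition {K} h recurrent = record
  { size     = K
  ; part     = λ j n → does (h n ≟ᶠ j)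
  ; nonzero  = λ j → InfinitelyOften⇒Nonzero _ λ N →
      let (n , N≤n , hn≡j) = recurrent j N in n , N≤n , dec-true (h n ≟ᶠ j) hn≡j
  ; disjoint = λ i j i≢j → 0 , λ n _ → disjoint-at i≢j n
  ; covers   = 0 , λ n _ → h n , dec-true (h n ≟ᶠ h n) refl
  }
  where
  disjoint-at : ∀ {i j} → i ≢ j → ∀ n → (does (h n ≟ᶠ i) ∧ does (h n ≟ᶠ j)) ≡ false
  disjoint-at {i} {j} i≢j n with h n ≟ᶠ i
  ... | yes hn≡i = dec-false (h n ≟ᶠ j) (λ hn≡j → i≢j (trans (sym hn≡i) hn≡j))
  ... | no _     = refl

module _ {h : ℕ → Fin K} {recurrent : Recurrent h} where

  colourPartition-edge⁺ : ∀ {j j′} → InfinitelyOften (λ n → h n ≡ j × h (suc n) ≡ j′) →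
                          E (Gσ (colourPartition h recurrent)) j j′
  colourPartition-edge⁺ {j} {j′} often = InfinitelyOften⇒Nonzero _ λ N →
    let (n , N≤n , hn≡j , h1+n≡j′) = often N in
    suc n , m≤n⇒m≤1+n N≤n , cong₂ _∧_ (dec-true (h n ≟ᶠ j) hn≡j) (dec-true (h (suc n) ≟ᶠ j′) h1+n≡j′)

  colourPartition-refines : (P : Partition) (π : Fin K → Fin (size P)) →
                            Eventually (λ n → part P (π (h n)) n ≡ true) →
                            Refines (colourPartition h recurrent) P π
  colourPartition-refines P π (N , inside) j = N , λ n N≤n → outside-empty n (inside n N≤n)
    where
    outside-empty : ∀ n → part P (π (h n)) n ≡ true → (does (h n ≟ᶠ j) ∧ not (part P (π j) n)) ≡ false
    outside-empty n hn-inside with h n ≟ᶠ j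
    ... | yes refl rewrite hn-inside = refl
    ... | no _     = refl

-- The fallback member is junk: colourOf-correct holds only where P covers n.
colourOf : (P : Partition) → ℕ → Fin (size P)
colourOf P n with any? (λ i → part P i n ≟ᵇ true)
... | yes (i , _) = i
... | no _        = proj₁ (proj₂ (covers P) (proj₁ (covers P)) ≤-refl)

colourOf-correct : (P : Partition) → Eventually (λ n → part P (colourOf P n) n ≡ true)
colourOf-correct P = proj₁ (covers P) , λ n N≤n → correct-at n (proj₂ (covers P) n N≤n)
  where
  correct-at : ∀ n → ∃[ i ] (part P i n ≡ true) → part P (colourOf P n) n ≡ true
  correct-at n covered with any? (λ i → part P i n ≟ᵇ true)
  ... | yes (_ , inside) = inside
  ... | no uncovered     = contradiction covered uncovered

module Walks (G : Digraph) {k : ℕ} (φ : Fin (V G) → Fin k) (c : ℕ → Fin k) where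

  Vertex : Set
  Vertex = Fin (V G)

  EdgeSet : Set₁
  EdgeSet = Vertex → Vertex → Set

  ∅ : EdgeSet
  ∅ _ _ = ⊥

  ⟨_⇒_⟩ : Vertex → Vertex → EdgeSet
  ⟨ u ⇒ w ⟩ x y = x ≡ u × y ≡ w

  _∪_ : EdgeSet → EdgeSet → EdgeSet
  (U ∪ U′) x y = U x y ⊎ U′ x y

  _⊆_ : EdgeSet → EdgeSet → Set
  U ⊆ U′ = ∀ {x y} → U x y → U′ x y

  Traverses : (ℕ → Vertex) → ℕ → ℕ → Vertex → Vertex → Set
  Traverses p a b x y = ∃[ n ] (a ≤ n × n < b × p n ≡ x × p (suc n) ≡ y)

  record Walk (a b : ℕ) (u w : Vertex) (U : EdgeSet) : Set where
    field
      path      : ℕ → Vertex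
      lies-over : ∀ n → a ≤ n → n ≤ b → φ (path n) ≡ c n
      steps     : ∀ n → a ≤ n → n < b → E G (path n) (path (suc n))
      starts    : path a ≡ u
      ends      : path b ≡ w
      traverses : ∀ {x y} → U x y → Traverses path a b x y

  private
    variable
      a b e n : ℕ
      u w z : Vertex
      U U′ : EdgeSet

  walk-mono : U′ ⊆ U → Walk a b u w U → Walk a b u w U′
  walk-mono U′⊆U walk = record { Walk walk ; traverses = traverses ∘ U′⊆U }
    where open Walk walk

  walk-ends-over : a ≤ b → Walk a b u w U → φ w ≡ c b
  walk-ends-over {b = b} a≤b walk = trans (cong φ (sym ends)) (lies-over b a≤b ≤-refl)
    where open Walk walk

  walk-stay : φ u ≡ c a → Walk a a u u ∅
  walk-stay {u = u} φu≡ca = record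
    { path      = λ _ → u
    ; lies-over = λ n a≤n n≤a → trans φu≡ca (cong c (≤-antisym a≤n n≤a))
    ; steps     = λ n a≤n n<a → contradiction (≤-<-trans a≤n n<a) (<-irrefl refl)
    ; starts    = refl
    ; ends      = refl
    ; traverses = λ ()
    }

  walk-stay-endpoints : Walk a a u w U → u ≡ w
  walk-stay-endpoints walk = trans (sym starts) ends
    where open Walk walk

  walk-stay-traverses-nothing : Walk a a u w U → ∀ {x y} → ¬ U x y
  walk-stay-traverses-nothing walk Uxy with Walk.traverses walk Uxy
  ... | n , a≤n , n<a , _ = <-irrefl refl (≤-<-trans a≤n n<a)

  walk-step : φ u ≡ c n → φ w ≡ c (suc n) → E G u w → Walk n (suc n) u w ⟨ u ⇒ w ⟩
  walk-step {u} {n} {w} φu φw u→w = record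
    { path      = path
    ; lies-over = lies-over
    ; steps     = λ m n≤m m<1+n → subst₂ (E G) (sym (at-n (≤-pred m<1+n))) (sym (at-1+n (s≤s n≤m))) u→w
    ; starts    = at-n ≤-refl
    ; ends      = at-1+n ≤-refl
    ; traverses = λ { (refl , refl) → n , ≤-refl , ≤-refl , at-n ≤-refl , at-1+n ≤-refl }
    }
    where
    path : ℕ → Vertex
    path = splice n (λ _ → u) (λ _ → w)
    at-n : ∀ {m} → m ≤ n → path m ≡ u
    at-n = splice-≤ _ _
    at-1+n : ∀ {m} → n < m → path m ≡ w
    at-1+n = splice-> _ _
    lies-over : ∀ m → n ≤ m → m ≤ suc n → φ (path m) ≡ c m
    lies-over m n≤m m≤1+n with ≤-<-connex m n
    ... | inj₁ m≤n = trans (cong φ (at-n m≤n)) (trans φu (cong c (≤-antisym n≤m m≤n)))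
    ... | inj₂ n<m = trans (cong φ (at-1+n n<m)) (trans φw (cong c (≤-antisym n<m m≤1+n)))

  concat : a ≤ b → b ≤ e → Walk a b u w U → Walk b e w z U′ → Walk a e u z (U ∪ U′)
  concat {a} {b} {e} a≤b b≤e first second = record
    { path      = path
    ; lies-over = lies-over
    ; steps     = steps
    ; starts    = trans (in-first a≤b) F.starts
    ; ends      = trans (in-second b≤e) S.ends
    ; traverses = λ { (inj₁ Uxy)  → traverses-first (F.traverses Uxy)
                    ; (inj₂ U′xy) → traverses-second (S.traverses U′xy) }
    }
    where
    module F = Walk first
    module S = Walk second
    path : ℕ → Vertex
    path = splice b F.path S.path
    in-first : ∀ {m} → m ≤ b → path m ≡ F.path m
    in-first = splice-≤ _ _
    in-second : ∀ {m} → b ≤ m → path m ≡ S.path m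
    in-second {m} b≤m with m≤n⇒m<n∨m≡n b≤m
    ... | inj₁ b<m  = splice-> _ _ b<m
    ... | inj₂ refl = trans (in-first ≤-refl) (trans F.ends (sym S.starts))
    lies-over : ∀ n → a ≤ n → n ≤ e → φ (path n) ≡ c n
    lies-over n a≤n n≤e with ≤-<-connex n b
    ... | inj₁ n≤b = trans (cong φ (in-first n≤b)) (F.lies-over n a≤n n≤b)
    ... | inj₂ b<n = trans (cong φ (in-second (<⇒≤ b<n))) (S.lies-over n (<⇒≤ b<n) n≤e)
    steps : ∀ n → a ≤ n → n < e → E G (path n) (path (suc n))
    steps n a≤n n<e with ≤-<-connex (suc n) b
    ... | inj₁ n<b = subst₂ (E G) (sym (in-first (<⇒≤ n<b))) (sym (in-first n<b)) (F.steps n a≤n n<b)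
    ... | inj₂ b<1+n = subst₂ (E G) (sym (in-second (≤-pred b<1+n))) (sym (in-second (<⇒≤ b<1+n)))
                                (S.steps n (≤-pred b<1+n) n<e)
    traverses-first : ∀ {x y} → Traverses F.path a b x y → Traverses path a e x y
    traverses-first (n , a≤n , n<b , at-x , at-y) =
      n , a≤n , <-≤-trans n<b b≤e , trans (in-first (<⇒≤ n<b)) at-x , trans (in-first n<b) at-y
    traverses-second : ∀ {x y} → Traverses S.path b e x y → Traverses path a e x y
    traverses-second (n , b≤n , n<e , at-x , at-y) =
      n , ≤-trans a≤b b≤n , n<e , trans (in-second b≤n) at-x , trans (in-second (m≤n⇒m≤1+n b≤n)) at-y

  walk-extend : a ≤ n → Walk a n u w U → E G w z → φ z ≡ c (suc n) → Walk a (suc n) u z (U ∪ ⟨ w ⇒ z ⟩)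
  walk-extend {n = n} a≤n walk w→z φz =
    concat a≤n (n≤1+n n) walk (walk-step (walk-ends-over a≤n walk) φz w→z)

  record InfiniteWalk (a : ℕ) (U : EdgeSet) : Set where
    field
      path            : ℕ → Vertex
      lies-over       : ∀ n → a ≤ n → φ (path n) ≡ c n
      steps           : ∀ n → a ≤ n → E G (path n) (path (suc n))
      traverses-often : ∀ {x y} → U x y → InfinitelyOften (λ n → path n ≡ x × path (suc n) ≡ y)

  concatenate : {cut : ℕ → ℕ} → StrictlyIncreasing cut →
                (∀ K → Walk (cut K) (cut (suc K)) u u U) → InfiniteWalk (cut 0) U
  concatenate {U = U} {cut = cut} cut-increasing walk = record
    { path            = path
    ; lies-over       = λ n cut₀≤n → let (≥cut , <cut) = inBlock-block cut₀≤n in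
                          Walk.lies-over (walk (block n)) n ≥cut (<⇒≤ <cut)
    ; steps           = λ n cut₀≤n → let (≥cut , <cut) = inBlock-block cut₀≤n in
                          subst (E G (path n)) (sym (path-suc cut₀≤n)) (Walk.steps (walk (block n)) n ≥cut <cut)
    ; traverses-often = traverses-often
    }
    where
    open Increasing cut-increasing
    path : ℕ → Vertex
    path n = Walk.path (walk (block n)) n
    path-suc : ∀ {n} → cut 0 ≤ n → path (suc n) ≡ Walk.path (walk (block n)) (suc n)
    path-suc {n} cut₀≤n with block-suc cut₀≤n
    ... | inj₁ same = cong (λ K → Walk.path (walk K) (suc n)) same
    ... | inj₂ (cut≡1+n , next) = begin
      Walk.path (walk (block (suc n))) (suc n)             ≡⟨ cong (λ K → Walk.path (walk K) (suc n)) next ⟩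
      Walk.path (walk (suc (block n))) (suc n)             ≡⟨ cong (Walk.path (walk _)) (sym cut≡1+n) ⟩
      Walk.path (walk (suc (block n))) (cut (suc (block n))) ≡⟨ trans (Walk.starts (walk _)) (sym (Walk.ends (walk _))) ⟩
      Walk.path (walk (block n)) (cut (suc (block n)))     ≡⟨ cong (Walk.path (walk _)) cut≡1+n ⟩
      Walk.path (walk (block n)) (suc n)                   ∎
      where open ≡-Reasoning
    traverses-often : ∀ {x y} → U x y → InfinitelyOften (λ n → path n ≡ x × path (suc n) ≡ y)
    traverses-often Uxy N with Walk.traverses (walk N) Uxy
    ... | n , cutN≤n , n<cut , at-x , at-y = n , ≤-trans (increasing-inflationary N) cutN≤n ,
      trans (cong (λ K → Walk.path (walk K) n) in-N) at-x ,
      trans (path-suc (≤-trans (increasing-≤ z≤n) cutN≤n)) (trans (cong (λ K → Walk.path (walk K) (suc n)) in-N) at-y)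
      where
      in-N : block n ≡ N
      in-N = block-unique (cutN≤n , n<cut)

record Monochromatic (χ : ℕ → ℕ → A) : Set where
  field
    cut            : ℕ → ℕ
    cut-increasing : StrictlyIncreasing cut
    colour         : A
    cut-colour     : ∀ K → χ (cut K) (cut (suc K)) ≡ colour

record Recolouring (g : ℕ → A) : Set where
  field
    colours      : ℕ
    colour       : ℕ → Fin colours
    recurrent    : Recurrent colour
    value        : Fin colours → A
    value-colour : Eventually (λ n → value (colour n) ≡ g n)

module _ (g : ℕ → Fin (suc (suc K))) (i₀ : Fin (suc (suc K))) where

  punchOut-colouring : ℕ → Fin (suc K)
  punchOut-colouring n with g n ≟ᶠ i₀
  ... | yes _    = zero
  ... | no gn≢i₀ = punchOut (gn≢i₀ ∘ sym)

  punchIn-punchOut-colouring : ∀ n → g n ≢ i₀ → punchIn i₀ (punchOut-colouring n) ≡ g n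
  punchIn-punchOut-colouring n gn≢i₀ with g n ≟ᶠ i₀
  ... | yes gn≡i₀ = contradiction gn≡i₀ gn≢i₀
  ... | no _      = punchIn-punchOut _

  punchIn-recolouring : Eventually (λ n → g n ≢ i₀) → Recolouring punchOut-colouring → Recolouring g
  punchIn-recolouring avoids R = record
    { colours      = colours
    ; colour       = colour
    ; recurrent    = recurrent
    ; value        = punchIn i₀ ∘ value
    ; value-colour = proj₁ both , λ n ≤n → trans (cong (punchIn i₀) (proj₁ (proj₂ both n ≤n)))
                                                 (punchIn-punchOut-colouring n (proj₂ (proj₂ both n ≤n)))
    }
    where
    open Recolouring R
    both : Eventually (λ n → value (colour n) ≡ punchOut-colouring n × g n ≢ i₀)
    both = eventually-∧ value-colour avoids

module Classical (em : ExcludedMiddle (lsuc 0ℓ)) where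

  -- The classical constructions are opaque: only their specifications are used, and letting the
  -- typechecker unfold them makes conversion checking prohibitively slow.
  opaque
    decide : (P : Set) → Dec P
    decide P = Dec.map′ lower lift (em {Lift _ P})

  stable : {P : Set} → ¬ ¬ P → P
  stable = decidable-stable (decide _)

  ¬InfinitelyOften⇒Eventually¬ : {Q : ℕ → Set} → ¬ InfinitelyOften Q → Eventually (¬_ ∘ Q)
  ¬InfinitelyOften⇒Eventually¬ rare = stable λ notEventually → rare λ N → stable λ none →
    notEventually (N , λ n N≤n q → none (n , N≤n , q))

  Nonzero⇒InfinitelyOften : (X : Subset) → Nonzero X → InfinitelyOften (λ n → X n ≡ true)
  Nonzero⇒InfinitelyOften X nonzero = stable λ rare →
    let (N , never) = ¬InfinitelyOften⇒Eventually¬ rare in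
    nonzero (N , λ n N≤n → ¬-not (never n N≤n))

  pigeonhole-Fin : {Q : ℕ → Set} (g : ℕ → Fin K) → InfinitelyOften Q →
                   ∃[ i ] InfinitelyOften (λ n → Q n × g n ≡ i)
  pigeonhole-Fin g often = stable λ none →
    let (N , rare) = eventually-∀ (λ i → ¬InfinitelyOften⇒Eventually¬ (λ oft → none (i , oft)))
        (n , N≤n , q) = often N
    in rare n N≤n (g n) (q , refl)

  pigeonhole : {Q : ℕ → Set} → Finite A → (f : ℕ → A) → InfinitelyOften Q →
               ∃[ a ] InfinitelyOften (λ n → Q n × f n ≡ a)
  pigeonhole {Q = Q} (K , ι) f often with pigeonhole-Fin (Injection.to ι ∘ f) often
  ... | i , oft = f (proj₁ (oft 0)) , λ N → same-value (oft N)
    where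
    same-value : ∀ {N} → ∃[ n ] (N ≤ n × Q n × Injection.to ι (f n) ≡ i) →
                 ∃[ n ] (N ≤ n × Q n × f n ≡ f (proj₁ (oft 0)))
    same-value (n , N≤n , q , ιfn≡i) =
      n , N≤n , q , Injection.injective ι (trans ιfn≡i (sym (proj₂ (proj₂ (proj₂ (oft 0))))))

  opaque
    ramsey : Finite A → (χ : ℕ → ℕ → A) → Monochromatic χ
    ramsey {A} finA χ = record
      { cut            = x ∘ index
      ; cut-increasing = λ K → proj₁ (x-colour (enumerate-increasing (proj₂ recurring) K))
      ; colour         = proj₁ recurring
      ; cut-colour     = λ K → trans (proj₂ (x-colour (enumerate-increasing (proj₂ recurring) K)))
                                     (proj₂ (enumerate-satisfies (proj₂ recurring) K))
      }
      where
      Infinite : Set₁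
      Infinite = Σ (ℕ → Set) InfinitelyOften

      point : Infinite → ℕ
      point X = proj₁ (proj₂ X 0)

      point-∈ : (X : Infinite) → proj₁ X (point X)
      point-∈ X = proj₂ (proj₂ (proj₂ X 0))

      beyond : Infinite → ℕ → Set
      beyond X y = proj₁ X y × point X < y

      beyond-often : (X : Infinite) → InfinitelyOften (beyond X)
      beyond-often X N with proj₂ X (N ⊔ suc (point X))
      ... | n , ≤n , Xn = n , m⊔n≤o⇒m≤o N _ ≤n , Xn , m⊔n≤o⇒n≤o N _ ≤n

      split : (X : Infinite) → ∃[ a ] InfinitelyOften (λ y → beyond X y × χ (point X) y ≡ a)
      split X = pigeonhole finA (χ (point X)) (beyond-often X)

      stage : ℕ → Infinite
      stage zero    = (λ _ → ⊤) , λ N → N , ≤-refl , tt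
      stage (suc i) = (λ y → beyond (stage i) y × χ (point (stage i)) y ≡ proj₁ (split (stage i)))
                    , proj₂ (split (stage i))

      stage-antitone : ∀ {i j y} → i ≤ j → proj₁ (stage j) y → proj₁ (stage i) y
      stage-antitone {j = zero}  z≤n y∈ = y∈
      stage-antitone {j = suc j} i≤1+j y∈ with m≤n⇒m<n∨m≡n i≤1+j
      ... | inj₁ i<1+j = stage-antitone (≤-pred i<1+j) (proj₁ (proj₁ y∈))
      ... | inj₂ refl  = y∈

      x : ℕ → ℕ
      x i = point (stage i)

      a : ℕ → A
      a i = proj₁ (split (stage i))

      x-colour : ∀ {i j} → i < j → x i < x j × χ (x i) (x j) ≡ a i
      x-colour {j = j} i<j with stage-antitone i<j (point-∈ (stage j))
      ... | (_ , xi<xj) , colour-a = xi<xj , colour-a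

      recurring : ∃[ s ] InfinitelyOften (λ i → ⊤ × a i ≡ s)
      recurring = pigeonhole finA a (λ N → N , ≤-refl , tt)

      index : ℕ → ℕ
      index = enumerate (proj₂ recurring)

  recurrent-recolouring : (g : ℕ → Fin K) → Recurrent g → Recolouring g
  recurrent-recolouring g rec = record
    { colours = _ ; colour = g ; recurrent = rec ; value = λ j → j ; value-colour = 0 , λ _ _ → refl }

  recolour-Fin : ∀ K (g : ℕ → Fin K) → Recolouring g
  recolour-Fin zero g with g 0
  ... | ()
  recolour-Fin (suc zero) g = recurrent-recolouring g λ { zero N → N , ≤-refl , only-zero (g N) }
    where
    only-zero : (i : Fin 1) → i ≡ zero
    only-zero zero = refl
  recolour-Fin (suc (suc K)) g = recolour-Fin-step g (decide _) (recolour-Fin (suc K))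
    where
    recolour-Fin-step : (g : ℕ → Fin (suc (suc K))) → Dec (∃[ i ] ¬ InfinitelyOften (λ n → g n ≡ i)) →
                        (∀ g′ → Recolouring g′) → Recolouring g
    recolour-Fin-step g (no allRecur) _ = recurrent-recolouring g (λ i → stable (λ rare → allRecur (i , rare)))
    recolour-Fin-step g (yes (i₀ , rare)) recolour-smaller = punchIn-recolouring g i₀
      (¬InfinitelyOften⇒Eventually¬ rare) (recolour-smaller (punchOut-colouring g i₀))

  opaque
    recolour : Finite A → (g : ℕ → A) → Recolouring g
    recolour (K , ι) g = record
      { colours = colours ; colour = colour ; recurrent = recurrent
      ; value = g ∘ occurrence
      ; value-colour = M , λ n M≤n → Injection.injective ι (begin
          Injection.to ι (g (occurrence (colour n)))  ≡⟨ value-colour-at (occurrence (colour n)) (occurrence-late _) ⟨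
          value (colour (occurrence (colour n)))      ≡⟨ cong value (occurrence-colour (colour n)) ⟩
          value (colour n)                            ≡⟨ value-colour-at n M≤n ⟩
          Injection.to ι (g n)                        ∎)
      }
      where
      open Recolouring (recolour-Fin K (Injection.to ι ∘ g))
      open ≡-Reasoning
      M : ℕ
      M = proj₁ value-colour
      value-colour-at : ∀ n → M ≤ n → value (colour n) ≡ Injection.to ι (g n)
      value-colour-at = proj₂ value-colour
      occurrence : Fin colours → ℕ
      occurrence j = proj₁ (recurrent j M)
      occurrence-late : ∀ j → M ≤ occurrence j
      occurrence-late j = proj₁ (proj₂ (recurrent j M))
      occurrence-colour : ∀ j → colour (occurrence j) ≡ j
      occurrence-colour j = proj₂ (proj₂ (recurrent j M))

  module TruthTable {I : Set} {m : ℕ} (enum : Fin m ↔ I) where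

    table : (I → Set) → Vec Bool m
    table Q = tabulate (λ i → does (decide (Q (Inverse.to enum i))))

    Holds : Vec Bool m → I → Set
    Holds ν q = lookup ν (Inverse.from enum q) ≡ true

    table-sound : ∀ {Q} q → Holds (table Q) q → Q q
    table-sound {Q} q holds = subst Q (Inverse.strictlyInverseˡ enum q)
      (does-true (decide _) (trans (sym (lookup∘tabulate _ (Inverse.from enum q))) holds))

    table-complete : ∀ {Q} q → Q q → Holds (table Q) q
    table-complete {Q} q Qq = trans (lookup∘tabulate _ (Inverse.from enum q))
      (dec-true (decide _) (subst Q (sym (Inverse.strictlyInverseˡ enum q)) Qq))

  colourPartition-edge⁻ : {h : ℕ → Fin K} {recurrent : Recurrent h} → ∀ {j j′} →
                          E (Gσ (colourPartition h recurrent)) j j′ →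
                          InfinitelyOften (λ n → h n ≡ j × h (suc n) ≡ j′)
  colourPartition-edge⁻ {h = h} {j = j} {j′} edge N with Nonzero⇒InfinitelyOften _ edge (suc N)
  ... | suc n , 1+N≤1+n , both = n , ≤-pred 1+N≤1+n ,
    does-true (h n ≟ᶠ j) (∧-conicalˡ _ _ both) , does-true (h (suc n) ≟ᶠ j′) (∧-conicalʳ _ _ both)

  Gσ-edge : (P : Partition) → ∃[ i ] ∃[ j ] E (Gσ P) i j
  Gσ-edge P = i , j , InfinitelyOften⇒Nonzero _ λ N →
    let (n , N≤n , M≤n , same) = often N in suc n , m≤n⇒m≤1+n N≤n , both-inside M≤n same
    where
    M : ℕ
    M = proj₁ (colourOf-correct P)
    inside : ∀ n → M ≤ n → part P (colourOf P n) n ≡ true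
    inside = proj₂ (colourOf-correct P)
    transition : ∃[ ij ] InfinitelyOften (λ n → M ≤ n × (colourOf P n , colourOf P (suc n)) ≡ ij)
    transition = pigeonhole (finite-× (finite-Fin _) (finite-Fin _)) (λ n → colourOf P n , colourOf P (suc n))
                            (λ N → N ⊔ M , m≤m⊔n N M , m≤n⊔m N M)
    i j : Fin (size P)
    i = proj₁ (proj₁ transition)
    j = proj₂ (proj₁ transition)
    often : InfinitelyOften (λ n → M ≤ n × (colourOf P n , colourOf P (suc n)) ≡ (i , j))
    often = proj₂ transition
    both-inside : ∀ {n} → M ≤ n → (colourOf P n , colourOf P (suc n)) ≡ (i , j) →
                  (part P i n ∧ part P j (suc n)) ≡ true
    both-inside {n} M≤n same = cong₂ _∧_
      (subst (λ i′ → part P i′ n ≡ true) (cong proj₁ same) (inside n M≤n))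
      (subst (λ j′ → part P j′ (suc n) ≡ true) (cong proj₂ same) (inside (suc n) (m≤n⇒m≤1+n M≤n)))

  module _ (P : Partition) (H : Digraph) (φ : Fin (V H) → Fin (size P)) where
    open Walks H φ (colourOf P) using (InfiniteWalk)

    realize-by-walk : StronglyConnected H → ∃[ x ] ∃[ y ] E H x y → ∀ {a} → InfiniteWalk a (E H) →
                      Σ Partition λ P′ → Realizes P′ P H φ
    realize-by-walk strong (x , y , x→y) {a} walk =
      colourPartition path recurrent , φ , refines , (λ v → v) ,
      (Identity.bijective _≡_ , λ v v′ → forward , backward) , λ _ → refl
      where
      open InfiniteWalk walk
      out-edge : ∀ {v} → Star (E H) v x → ∃[ z ] E H v z
      out-edge ε         = y , x→y
      out-edge (v→ ◅ _) = _ , v→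
      recurrent : Recurrent path
      recurrent v N with out-edge (strong v x)
      ... | _ , v→z = let (n , N≤n , at-v , _) = traverses-often v→z N in n , N≤n , at-v
      refines : Refines (colourPartition path recurrent) P φ
      refines = colourPartition-refines {h = path} {recurrent = recurrent} P φ
        (let (N , both) = eventually-∧ (a , lies-over) (colourOf-correct P) in
         N , λ n N≤n → trans (cong (λ i → part P i n) (proj₁ (both n N≤n))) (proj₂ (both n N≤n)))
      forward : ∀ {v v′} → E H v v′ → E (Gσ (colourPartition path recurrent)) v v′
      forward = colourPartition-edge⁺ {h = path} {recurrent = recurrent} ∘ traverses-often
      backward : ∀ {v v′} → E (Gσ (colourPartition path recurrent)) v v′ → E H v v′
      backward edge with colourPartition-edge⁻ {h = path} {recurrent = recurrent} edge a
      ... | n , a≤n , at-v , at-v′ = subst₂ (E H) at-v at-v′ (steps n a≤n)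

module Construction (em : ExcludedMiddle (lsuc 0ℓ)) (P : Partition) (H : Digraph)
                    (φ : Fin (V H) → Fin (size P)) where

  open Classical em
  open Walks H φ (colourOf P)

  c : ℕ → Fin (size P)
  c = colourOf P

  Requires : Bool → Vertex → Vertex → EdgeSet
  Requires false _ _ = ∅
  Requires true  x y = ⟨ x ⇒ y ⟩

  requires-∨ : ∀ b₁ b₂ {x y} → Requires (b₁ ∨ b₂) x y ⊆ (Requires b₁ x y ∪ Requires b₂ x y)
  requires-∨ true  _ x→y = inj₁ x→y
  requires-∨ false _ x→y = inj₂ x→y

  Query : Set
  Query = Vertex × Vertex × Vertex × Vertex × Bool

  Answers : ℕ → ℕ → Query → Set
  Answers a b (u , w , x , y , r) = Walk a b u w (Requires r x y)

  queries : ℕ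
  queries = V H * (V H * (V H * (V H * 2)))

  open TruthTable {Query} {queries} (Fin-*-↔ (V H) (Fin-*-↔ (V H) (Fin-*-↔ (V H) (Fin-*-↔ (V H) 2↔Bool))))

  Type : Set
  Type = Vec Bool queries

  type : ℕ → ℕ → Type
  type a b = table (Answers a b)

  type-sound : ∀ {a b} q → Holds (type a b) q → Answers a b q
  type-sound {a} {b} = table-sound {Q = Answers a b}

  type-complete : ∀ {a b} q → Answers a b q → Holds (type a b) q
  type-complete {a} {b} = table-complete {Q = Answers a b}

  open Monochromatic (ramsey (finite-Vec finite-Bool queries) type) using (cut; cut-increasing; cut-colour)
  open Increasing cut-increasing

  block-transfer : ∀ {K K′} q → Answers (cut K) (cut (suc K)) q → Answers (cut K′) (cut (suc K′)) q
  block-transfer {K} {K′} q answer =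
    type-sound q (subst (λ ν → Holds ν q) (trans (cut-colour K) (sym (cut-colour K′))) (type-complete q answer))

  start : ℕ → ℕ
  start n = cut (block n)

  isCut : ℕ → Bool
  isCut n = does (start n ≟ n)

  start-≤ : ∀ {n} → cut 0 ≤ n → start n ≤ n
  start-≤ cut₀≤n = proj₁ (inBlock-block cut₀≤n)

  isCut-start : ∀ {n} → isCut n ≡ true → start n ≡ n
  isCut-start {n} = does-true (start n ≟ n)

  start-isCut : ∀ {n} → start n ≡ n → isCut n ≡ true
  start-isCut {n} = dec-true (start n ≟ n)

  isCut-cut : ∀ K → isCut (cut K) ≡ true
  isCut-cut K = start-isCut (cong cut (block-unique {K} {cut K} (inBlock-start K)))

  start-suc-inside : ∀ {n} → cut 0 ≤ n → isCut (suc n) ≡ false → start (suc n) ≡ start n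
  start-suc-inside {n} cut₀≤n notCut with block-suc cut₀≤n
  ... | inj₁ same = cong cut same
  ... | inj₂ (cut≡1+n , next) =
    contradiction (trans (sym (start-isCut (trans (cong cut next) cut≡1+n))) notCut) λ ()

  start-suc-cut : ∀ {n} → cut 0 ≤ n → isCut (suc n) ≡ true → cut (suc (block n)) ≡ suc n
  start-suc-cut {n} cut₀≤n isCut′ with block-suc cut₀≤n
  ... | inj₂ (cut≡1+n , _) = cut≡1+n
  ... | inj₁ same = contradiction (subst (_≤ n) (trans (cong cut (sym same)) (isCut-start isCut′)) (start-≤ cut₀≤n))
                                  (n≮n n)

  Label : Set
  Label = Fin (size P) × Bool × Type

  label : ℕ → Label
  label n = c n , isCut n , type (start n) n

  open Recolouring (recolour (finite-× (finite-Fin _) (finite-× finite-Bool (finite-Vec finite-Bool queries))) label)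

  P′ : Partition
  P′ = colourPartition colour recurrent

  π : Fin colours → Fin (size P)
  π j = proj₁ (value j)

  cutFlag : Fin colours → Bool
  cutFlag j = proj₁ (proj₂ (value j))

  typeOf : Fin colours → Type
  typeOf j = proj₂ (proj₂ (value j))

  P′-refines : Refines P′ P π
  P′-refines = colourPartition-refines {h = colour} {recurrent = recurrent} P π
    (let (N , both) = eventually-∧ value-colour (colourOf-correct P) in
     N , λ n N≤n → trans (cong (λ ℓ → part P (proj₁ ℓ) n) (proj₁ (both n N≤n))) (proj₂ (both n N≤n)))

  Labelled : Fin colours → ℕ → Set
  Labelled j n = cut 0 ≤ n × label n ≡ value j

  labelled-π : ∀ {j n} → Labelled j n → π j ≡ c n
  labelled-π (_ , same) = sym (cong proj₁ same)

  labelled-cutFlag : ∀ {j n} → Labelled j n → cutFlag j ≡ isCut n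
  labelled-cutFlag (_ , same) = sym (cong (proj₁ ∘ proj₂) same)

  labelled-typeOf : ∀ {j n} → Labelled j n → typeOf j ≡ type (start n) n
  labelled-typeOf (_ , same) = sym (cong (proj₂ ∘ proj₂) same)

  settled : Eventually (λ n → value (colour n) ≡ label n × cut 0 ≤ n)
  settled = eventually-∧ value-colour (cut 0 , λ _ cut₀≤n → cut₀≤n)

  labelled-colour : ∀ {n} → proj₁ settled ≤ n → Labelled (colour n) n
  labelled-colour N≤n = let (same , cut₀≤n) = proj₂ settled _ N≤n in cut₀≤n , sym same

  labelled-edge : ∀ {j j′} → E (Gσ P′) j j′ → ∃[ n ] (Labelled j n × Labelled j′ (suc n))
  labelled-edge edge =
    let (n , N≤n , at-j , at-j′) = colourPartition-edge⁻ {h = colour} {recurrent = recurrent} edge (proj₁ settled) in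
    n , subst (λ i → Labelled i n) at-j (labelled-colour N≤n) ,
        subst (λ i → Labelled i (suc n)) at-j′ (labelled-colour (m≤n⇒m≤1+n N≤n))

  Partial : Fin colours → Query → Set
  Partial j q = Holds (typeOf j) q

  partial-sound : ∀ {j n} q → Labelled j n → Partial j q → Answers (start n) n q
  partial-sound q at-n = type-sound q ∘ subst (λ ν → Holds ν q) (labelled-typeOf at-n)

  partial-complete : ∀ {j n} q → Labelled j n → Answers (start n) n q → Partial j q
  partial-complete q at-n = subst (λ ν → Holds ν q) (sym (labelled-typeOf at-n)) ∘ type-complete q

  labelled-cut : ∀ {j} → cutFlag j ≡ true → ∃[ n ] (Labelled j n × start n ≡ n)
  labelled-cut {j} isCut′ =
    let (n , N≤n , at-j) = recurrent j (proj₁ settled)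
        at-n = subst (λ i → Labelled i n) at-j (labelled-colour N≤n)
    in n , at-n , isCut-start (trans (sym (labelled-cutFlag at-n)) isCut′)

  partial-at-cut : ∀ {j u w x y b} → cutFlag j ≡ true → Partial j (u , w , x , y , b) → u ≡ w × b ≡ false
  partial-at-cut {u = u} {w} {x} {y} {b} isCut′ partial = walk-stay-endpoints stay , no-edge b stay
    where
    n : ℕ
    n = proj₁ (labelled-cut isCut′)
    stay : Walk n n u w (Requires b x y)
    stay = subst (λ a → Walk a n u w (Requires b x y)) (proj₂ (proj₂ (labelled-cut isCut′)))
                 (partial-sound (u , w , x , y , b) (proj₁ (proj₂ (labelled-cut isCut′))) partial)
    no-edge : ∀ b → Walk n n u w (Requires b x y) → b ≡ false
    no-edge false _    = refl
    no-edge true  stay = contradiction (refl , refl) (walk-stay-traverses-nothing stay)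

  partial-reset : ∀ {j u x y} → cutFlag j ≡ true → φ u ≡ π j → Partial j (u , u , x , y , false)
  partial-reset {u = u} {x} {y} isCut′ φu≡πj =
    let (n , at-n , start≡n) = labelled-cut isCut′ in
    partial-complete (u , u , x , y , false) at-n
      (subst (λ a → Walk a n u u ∅) (sym start≡n) (walk-stay (trans φu≡πj (labelled-π at-n))))

  Laps : ℕ → Vertex → Vertex → EdgeSet → Set
  Laps r u w U = ∀ K → Walk (cut K) (cut (r + K)) u w U

  laps-concat : ∀ {r r′ u w z U U′} → Laps r u w U → Laps r′ w z U′ → Laps (r′ + r) u z (U ∪ U′)
  laps-concat {r} {r′} {u} {z = z} {U} {U′} first second K =
    subst (λ m → Walk (cut K) (cut m) u z (U ∪ U′)) (sym (+-assoc r′ r K))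
      (concat (increasing-≤ (m≤n+m K r)) (increasing-≤ (m≤n+m (r + K) r′)) (first K) (second (r + K)))

  module FromCompatibility (strong : StronglyConnected H) (φ-epi : Epi H (Gσ P) φ)
                           (W : Digraph) (W-strong : StronglyConnected W)
                           (φ̄ : Fin (V W) → Vertex) (ψ̄ : Fin (V W) → Fin colours)
                           (φ̄-epi : Epi W H φ̄) (ψ̄-epi : Epi W (Gσ P′) ψ̄)
                           (commutes : ∀ w → φ (φ̄ w) ≡ π (ψ̄ w)) where

    j₀ : Fin colours
    j₀ = colour (cut (proj₁ settled))

    j₀-cut : cutFlag j₀ ≡ true
    j₀-cut = trans (labelled-cutFlag (labelled-colour (increasing-inflationary (proj₁ settled)))) (isCut-cut (proj₁ settled))

    w₀ : Fin (V W)
    w₀ = proj₁ (proj₁ ψ̄-epi j₀)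

    w₀-cut : cutFlag (ψ̄ w₀) ≡ true
    w₀-cut = trans (cong cutFlag (proj₂ (proj₁ ψ̄-epi j₀))) j₀-cut

    v₀ : Vertex
    v₀ = φ̄ w₀

    module AlongEdge (x y : Vertex) where

      data Prefix : Vertex → Bool → Set where
        at-base : Prefix v₀ false
        after   : ∀ {r u b} → Laps (suc r) v₀ u (Requires b x y) → Prefix u b

      prefix-extend : ∀ {u w b₁ b₂} → Prefix u b₁ → Laps 1 u w (Requires b₂ x y) → Prefix w (b₁ ∨ b₂)
      prefix-extend at-base lap = after {r = 0} lap
      prefix-extend {b₂ = b₂} (after {r} {b = b₁} laps) lap =
        after {r = suc r} (walk-mono (requires-∨ b₁ b₂) ∘ laps-concat laps lap)

      -- Having walked in W to w, the shadow in 𝒱 consists of whole blocks from v₀ to entry followed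
      -- by a partial walk, recorded in the label ψ̄ w, from entry to φ̄ w; b says whether x → y was used.
      record Progress (w : Fin (V W)) (b : Bool) : Set where
        field
          entry        : Vertex
          prefix-uses  : Bool
          partial-uses : Bool
          prefix       : Prefix entry prefix-uses
          partial      : Partial (ψ̄ w) (entry , φ̄ w , x , y , partial-uses)
          uses         : prefix-uses ∨ partial-uses ≡ b

      arrive-at : ∀ {w′ n u b₁ b₂} (atCut : Bool) → isCut (suc n) ≡ atCut → cut 0 ≤ n →
                  Labelled (ψ̄ w′) (suc n) → Prefix u b₁ →
                  Walk (start n) (suc n) u (φ̄ w′) (Requires b₂ x y) → Progress w′ (b₁ ∨ b₂)
      arrive-at {w′} {n} {u} {b₁} {b₂} false inside cut₀≤n at-1+n prefix walk = record
        { entry = u ; prefix-uses = b₁ ; partial-uses = b₂ ; prefix = prefix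
        ; partial = partial-complete (u , φ̄ w′ , x , y , b₂) at-1+n
            (subst (λ a → Walk a (suc n) u (φ̄ w′) (Requires b₂ x y)) (sym (start-suc-inside cut₀≤n inside)) walk)
        ; uses = refl
        }
      arrive-at {w′} {n} {u} {b₁} {b₂} true atCut cut₀≤n at-1+n prefix walk = record
        { entry = φ̄ w′ ; prefix-uses = b₁ ∨ b₂ ; partial-uses = false
        ; prefix = prefix-extend prefix (λ K → block-transfer (u , φ̄ w′ , x , y , b₂) whole)
        ; partial = partial-reset (trans (labelled-cutFlag at-1+n) atCut) (commutes w′)
        ; uses = ∨-identityʳ _
        }
        where
        whole : Walk (cut (block n)) (cut (suc (block n))) u (φ̄ w′) (Requires b₂ x y)
        whole = subst (λ m → Walk (start n) m u (φ̄ w′) (Requires b₂ x y)) (sym (start-suc-cut cut₀≤n atCut)) walk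

      step : ∀ {w w′ b} (f : Bool → Bool) → (∀ b₁ b₂ → b₁ ∨ f b₂ ≡ f (b₁ ∨ b₂)) →
             (∀ b → Requires (f b) x y ⊆ (Requires b x y ∪ ⟨ φ̄ w ⇒ φ̄ w′ ⟩)) →
             E W w w′ → Progress w b → Progress w′ (f b)
      step {w} {w′} f f-∨ covered w→w′ progress =
        subst (Progress w′) (trans (f-∨ prefix-uses partial-uses) (cong f uses))
          (arrive-at (isCut (suc n)) refl (proj₁ at-n) at-1+n prefix (walk-mono (covered partial-uses) extended))
        where
        open Progress progress
        edge : ∃[ n ] (Labelled (ψ̄ w) n × Labelled (ψ̄ w′) (suc n))
        edge = labelled-edge (proj₂ (proj₂ ψ̄-epi) w w′ w→w′)
        n : ℕ
        n = proj₁ edge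
        at-n : Labelled (ψ̄ w) n
        at-n = proj₁ (proj₂ edge)
        at-1+n : Labelled (ψ̄ w′) (suc n)
        at-1+n = proj₂ (proj₂ edge)
        extended : Walk (start n) (suc n) entry (φ̄ w′) (Requires partial-uses x y ∪ ⟨ φ̄ w ⇒ φ̄ w′ ⟩)
        extended = walk-extend (start-≤ (proj₁ at-n)) (partial-sound (entry , φ̄ w , x , y , partial-uses) at-n partial)
                     (proj₂ (proj₂ φ̄-epi) w w′ w→w′) (trans (commutes w′) (labelled-π at-1+n))

      travel : ∀ {w w′ b} → Star (E W) w w′ → Progress w b → Progress w′ b
      travel ε              = id
      travel (w→ ◅ w→*) = travel w→* ∘ step id (λ _ _ → refl) (λ _ → inj₁) w→

      cross : ∀ {w w′ b} → φ̄ w ≡ x → φ̄ w′ ≡ y → E W w w′ → Progress w b → Progress w′ true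
      cross w↦x w′↦y = step (λ _ → true) (λ b₁ _ → ∨-zeroʳ b₁)
        (λ _ (x′≡x , y′≡y) → inj₂ (trans x′≡x (sym w↦x) , trans y′≡y (sym w′↦y)))

      initial : Progress w₀ false
      initial = record
        { entry = v₀ ; prefix-uses = false ; partial-uses = false ; prefix = at-base
        ; partial = partial-reset w₀-cut (commutes w₀) ; uses = refl }

      conclude : Progress w₀ true → ∃[ r ] Laps (suc r) v₀ v₀ ⟨ x ⇒ y ⟩
      conclude progress = closed (subst₂ Prefix (proj₁ trivial) uses-true prefix)
        where
        open Progress progress
        trivial : entry ≡ v₀ × partial-uses ≡ false
        trivial = partial-at-cut w₀-cut partial
        uses-true : prefix-uses ≡ true
        uses-true = trans (sym (∨-identityʳ prefix-uses)) (trans (cong (prefix-uses ∨_) (sym (proj₂ trivial))) uses)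
        closed : Prefix v₀ true → ∃[ r ] Laps (suc r) v₀ v₀ ⟨ x ⇒ y ⟩
        closed (after laps) = _ , laps

      loop-through : E H x y → ∃[ r ] Laps (suc r) v₀ v₀ ⟨ x ⇒ y ⟩
      loop-through x→y =
        let (w₁ , w₂ , w₁↦x , w₂↦y , w₁→w₂) = proj₁ (proj₂ φ̄-epi) x y x→y in
        conclude (travel (W-strong w₂ w₀) (cross w₁↦x w₂↦y w₁→w₂ (travel (W-strong w₀ w₁) initial)))

    Loop : EdgeSet → Set
    Loop U = ∃[ r ] Laps (suc r) v₀ v₀ U

    loop-mono : ∀ {U U′} → U′ ⊆ U → Loop U → Loop U′
    loop-mono U′⊆U (r , laps) = r , walk-mono U′⊆U ∘ laps

    loop-concat : ∀ {U U′} → Loop U → Loop U′ → Loop (U ∪ U′)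
    loop-concat (r , laps) (r′ , laps′) = r′ + suc r , laps-concat laps laps′

    some-edge : ∃[ x ] ∃[ y ] E H x y
    some-edge =
      let (i , j , i→j) = Gσ-edge P
          (x , y , _ , _ , x→y) = proj₁ (proj₂ φ-epi) i j i→j
      in x , y , x→y

    some-loop : Loop ∅
    some-loop = let (x , y , x→y) = some-edge in loop-mono (λ ()) (AlongEdge.loop-through x y x→y)

    loop-edge : ∀ x y → Dec (E H x y) → Loop (λ x′ y′ → (x′ , y′) ≡ (x , y) × E H x′ y′)
    loop-edge x y (yes x→y) = loop-mono (,-injective ∘ proj₁) (AlongEdge.loop-through x y x→y)
    loop-edge x y (no ¬x→y) =
      loop-mono (λ (same , x′→y′) → ¬x→y (subst (λ p → E H (proj₁ p) (proj₂ p)) same x′→y′)) some-loop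

    loop-list : ∀ S → Loop (λ x y → (x , y) ∈ S × E H x y)
    loop-list []            = loop-mono (λ { (() , _) }) some-loop
    loop-list ((x , y) ∷ S) =
      loop-mono (λ { (here same , x′→y′) → inj₁ (same , x′→y′) ; (there ∈S , x′→y′) → inj₂ (∈S , x′→y′) })
                (loop-concat (loop-edge x y (decide _)) (loop-list S))

    loop-all : Loop (E H)
    loop-all = loop-mono (λ x→y → ∈-cartesianProduct⁺ (∈-allFin _) (∈-allFin _) , x→y)
                         (loop-list (cartesianProduct (allFin _) (allFin _)))

    realization : Σ Partition λ P″ → Realizes P″ P H φ
    realization = realize-by-walk P H φ strong some-edge
      (concatenate {cut = λ G → cut (G * L)} (λ G → increasing-< (m<n+m (G * L) z<s)) (λ G → proj₂ loop-all (G * L)))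
      where
      L : ℕ
      L = suc (proj₁ loop-all)

  realize-from-compatible : StronglyConnected H → Epi H (Gσ P) φ → Compatible {Gσ P} H φ (Gσ P′) π →
                            Σ Partition λ P″ → Realizes P″ P H φ
  realize-from-compatible strong φ-epi (W , W-strong , φ̄ , ψ̄ , φ̄-epi , ψ̄-epi , commutes) =
    FromCompatibility.realization strong φ-epi W W-strong φ̄ ψ̄ φ̄-epi ψ̄-epi commutes

theorem11p2 : ExcludedMiddle (lsuc 0ℓ) → SystemPolarized
theorem11p2 em P H φ (strong , φ-epi) with Classical.decide em (Σ Partition λ P″ → Realizes P″ P H φ)
... | yes realized = inj₁ realized
... | no unrealized = inj₂ (P′ , π , P′-refines , unrealized ∘ realize-from-compatible strong φ-epi)
  where open Construction em P H φ
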